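{- Let $(E,f)$ be a polymatroid and let $L_0,L_1,L_2\subseteq E$ satisfy $f(L_i)=2$ for $i=0,1,2$, $f(L_i\cup L_j)=3$ for $i\neq j$, and $f(L_0\cup L_1\cup L_2)=4$. Let $(E\cup\{z\},g)$, with $z\notin E$, be an Ahlswede–Körner extension of $(E,f)$ for the pair $(L_1\cup L_2,\,L_0)$. Then $g(z\mid L_i)=0$ for each $i=0,1,2$.
   Context: A polymatroid is a pair $(E,f)$ with $E$ a finite set and $f:\mathcal P(E)\to\mathbb R$ monotone, submodular, with $f(\emptyset)=0$. Notation: for $X,Y,Z\subseteq E$, $f(X\mid Z)=f(X\cup Z)-f(Z)$ and $f(X:Y\mid Z)=f(X\cup Z)+f(Y\cup Z)-f(X\cup Y\cup Z)-f(Z)$; singletons are written without braces. A polymatroid $(E\cup Z,g)$ with $E\cap Z=\emptyset$ is an extension of $(E,f)$ if $g(X)=f(X)$ for all $X\subseteq E$. For $X,Y\subseteq E$, an extension $(E\cup Z,g)$ is an Ahlswede–Körner (AK) extension for the pair $(X,Y)$ if $g(Z\mid X)=0$ and $g(X'\mid Z)=g(X'\mid Y)$ for every $X'\subseteq X$. -}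

module Defs where

open import Level using (Level; suc; _⊔_)
open import Data.Nat using (ℕ)
import Data.Nat as N
open import Data.Fin using (Fin; zero)
open import Data.Fin.Subset using (Subset; _∪_; _∩_; _⊆_; ⊥; ⁅_⁆; outside)
open import Data.Vec using (_∷_)
open import Algebra.Core using (Op₁; Op₂)
open import Algebra.Structures using (IsCommutativeRing)
open import Relation.Binary.Core using (Rel)
open import Relation.Binary.Structures using (IsTotalOrder)

-- A (totally) ordered commutative ring; the real numbers are an instance.
-- Polymatroid rank functions take values in the carrier of such a structure.
record OrderedCommRing (c ℓ : Level) : Set (suc (c ⊔ ℓ)) where
  infix  4 _≈_ _≤_
  infixl 6 _+_ _-_
  infixl 7 _*_
  field
    Carrier : Set c
    _≈_     : Rel Carrier ℓ
    _≤_     : Rel Carrier ℓ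
    _+_     : Op₂ Carrier
    _*_     : Op₂ Carrier
    -_      : Op₁ Carrier
    0#      : Carrier
    1#      : Carrier
    isCommutativeRing : IsCommutativeRing _≈_ _+_ _*_ -_ 0# 1#
    isTotalOrder      : IsTotalOrder _≈_ _≤_
    +-mono-≤          : ∀ {x y} z → x ≤ y → x + z ≤ y + z
    *-nonneg          : ∀ {x y} → 0# ≤ x → 0# ≤ y → 0# ≤ x * y

  _-_ : Op₂ Carrier
  x - y = x + (- y)

  2# 3# 4# : Carrier
  2# = 1# + 1#
  3# = 2# + 1#
  4# = 3# + 1#

module _ {c ℓ : Level} (R : OrderedCommRing c ℓ) where
  open OrderedCommRing R

  record IsPolymatroid {n : ℕ} (f : Subset n → Carrier) : Set (c ⊔ ℓ) where
    field
      normalized : f ⊥ ≈ 0#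
      monotone   : ∀ {X Y} → X ⊆ Y → f X ≤ f Y
      submodular : ∀ X Y → f (X ∪ Y) + f (X ∩ Y) ≤ f X + f Y

  cond : {n : ℕ} → (Subset n → Carrier) → Subset n → Subset n → Carrier
  cond f X Z = f (X ∪ Z) - f Z

-- Embedding of subsets of E = Fin n into subsets of E ∪ {z} = Fin (1 + n),
-- where the new element z is  zero  and E is embedded via  suc .
emb : {n : ℕ} → Subset n → Subset (N.suc n)
emb X = outside ∷ X

zSet : {n : ℕ} → Subset (N.suc n)
zSet = ⁅ zero ⁆

module _ {c ℓ : Level} (R : OrderedCommRing c ℓ) where
  open OrderedCommRing R

  IsExtension : {n : ℕ} → (Subset n → Carrier) → (Subset (N.suc n) → Carrier) → Set ℓ
  IsExtension f g = ∀ X → g (emb X) ≈ f X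

  IsAKExtension : {n : ℕ} → (Subset n → Carrier) → (Subset (N.suc n) → Carrier)
                → Subset n → Subset n → Set (c ⊔ ℓ)
  IsAKExtension f g X Y =
    IsPolymatroid R g × IsExtension f g
    × (cond R g zSet (emb X) ≈ 0#)
    × (∀ X′ → X′ ⊆ X → cond R g (emb X′) zSet ≈ cond R g (emb X′) (emb Y))
    where open import Data.Product using (_×_)

{-# OPTIONS --safe #-}
module Submission where

-- Think of L₀, L₁, L₂ as three lines of projective space which meet pairwise
-- but do not span a plane: they then pass through a common point, and the
-- AK extension forces z to be that point. Applying the AK identity to
-- X′ = L₁ ∪ L₂ gives g(z) = f(L₁ ∪ L₂) + f(L₀) − f(L₀ ∪ L₁ ∪ L₂) = 1, and
-- applying it to X′ = Lᵢ (i = 1, 2) gives g(z ∪ Lᵢ) = f(L₀ ∪ Lᵢ) − f(L₀) + 1 = 2.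
-- Submodularity of g on z ∪ Lᵢ and L₀ ∪ Lᵢ yields g(z ∪ L₀ ∪ Lᵢ) ≤ 3, and
-- once more on z ∪ L₀ ∪ L₁ and z ∪ L₀ ∪ L₂ it yields g(z ∪ L₀) ≤ 3 + 3 − 4 = 2.

open import Defs
open import Level using (Level)
open import Data.Nat using (ℕ)
open import Data.Fin.Subset using (Subset; _∪_; _∩_; _⊆_; inside)
open import Data.Fin.Subset.Properties
  using (⊆-refl; p⊆p∪q; q⊆p∪q; x∈p∪q⁻; x∈p∩q⁺; ∪-comm; ∪-identityˡ; ∪-identityʳ; in⊆in; out⊆)
open import Data.Product using (_×_; _,_; proj₁; proj₂)
open import Data.Sum using (inj₁; inj₂)
open import Data.Vec using (_∷_)
open import Function.Bundles using (_⇔_; mk⇔; Equivalence)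
open import Relation.Binary.Bundles using (Poset)
open import Relation.Binary.Structures using (IsTotalOrder)
open import Relation.Binary.PropositionalEquality as ≡ using (_≡_)
open import Algebra.Bundles using (CommutativeRing; AbelianGroup)
import Algebra.Properties.Group as GroupProperties
import Algebra.Properties.CommutativeSemigroup as CommutativeSemigroupProperties
import Relation.Binary.Reasoning.PartialOrder as PosetReasoning

p∪[q∪r]⊆[p∪q]∪[p∪r] : ∀ {n} (p q r : Subset n) → p ∪ q ∪ r ⊆ (p ∪ q) ∪ (p ∪ r)
p∪[q∪r]⊆[p∪q]∪[p∪r] p q r x∈ with x∈p∪q⁻ p (q ∪ r) x∈
... | inj₁ x∈p = p⊆p∪q (p ∪ r) (p⊆p∪q q x∈p)
... | inj₂ x∈q∪r with x∈p∪q⁻ q r x∈q∪r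
...   | inj₁ x∈q = p⊆p∪q (p ∪ r) (q⊆p∪q p q x∈q)
...   | inj₂ x∈r = q⊆p∪q (p ∪ q) (p ∪ r) (q⊆p∪q p r x∈r)

embZ : ∀ {n} → Subset n → Subset (ℕ.suc n)
embZ X = inside ∷ X

zSet∪emb≡embZ : ∀ {n} (X : Subset n) → zSet ∪ emb X ≡ embZ X
zSet∪emb≡embZ X = ≡.cong (inside ∷_) (∪-identityˡ X)

emb∪zSet≡embZ : ∀ {n} (X : Subset n) → emb X ∪ zSet ≡ embZ X
emb∪zSet≡embZ X = ≡.cong (inside ∷_) (∪-identityʳ X)

module OrderedCommRingProperties {c ℓ : Level} (R : OrderedCommRing c ℓ) where
  open OrderedCommRing R public renaming (+-mono-≤ to +-monoˡ-≤)

  commutativeRing : CommutativeRing c ℓ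
  commutativeRing = record { isCommutativeRing = isCommutativeRing }

  open CommutativeRing commutativeRing public
    using (refl; sym; trans; reflexive; +-cong; +-congˡ; +-congʳ; +-assoc; +-comm)
  open CommutativeRing commutativeRing
    using (+-abelianGroup; +-commutativeSemigroup)
  open GroupProperties (AbelianGroup.group +-abelianGroup)
    using (//-rightDividesˡ; //-rightDividesʳ)
    renaming ( ∙-cancelˡ to +-cancelˡ; ∙-cancelʳ to +-cancelʳ
             ; x∙y⁻¹≈ε⇒x≈y to x-y≈0⇒x≈y; x≈y⇒x∙y⁻¹≈ε to x≈y⇒x-y≈0) public
  open CommutativeSemigroupProperties +-commutativeSemigroup using (xy∙z≈xz∙y)

  poset : Poset c ℓ ℓ
  poset = record { isPartialOrder = IsTotalOrder.isPartialOrder isTotalOrder }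

  open Poset poset public using (antisym) renaming (trans to ≤-trans)
  open PosetReasoning poset public

  +-mono-≤ : ∀ {x y u v} → x ≤ y → u ≤ v → x + u ≤ y + v
  +-mono-≤ {x} {y} {u} {v} x≤y u≤v = begin
    x + u ≤⟨ +-monoˡ-≤ u x≤y ⟩
    y + u ≈⟨ +-comm y u ⟩
    u + y ≤⟨ +-monoˡ-≤ y u≤v ⟩
    v + y ≈⟨ +-comm v y ⟩
    y + v ∎

  +-cancelʳ-≤ : ∀ {x y} z → x + z ≤ y + z → x ≤ y
  +-cancelʳ-≤ {x} {y} z x+z≤y+z = begin
    x           ≈⟨ //-rightDividesʳ z x ⟨
    x + z - z   ≤⟨ +-monoˡ-≤ (- z) x+z≤y+z ⟩
    y + z - z   ≈⟨ //-rightDividesʳ z y ⟩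
    y           ∎

  +-cancelˡ-≤ : ∀ {x y} z → z + x ≤ z + y → x ≤ y
  +-cancelˡ-≤ {x} {y} z z+x≤z+y = +-cancelʳ-≤ z (begin
    x + z  ≈⟨ +-comm x z ⟩
    z + x  ≤⟨ z+x≤z+y ⟩
    z + y  ≈⟨ +-comm z y ⟩
    y + z  ∎)

  -‿cross : ∀ {x y u v} → x - y ≈ u - v → x + v ≈ u + y
  -‿cross {x} {y} {u} {v} eq = begin-equality
    x + v           ≈⟨ +-congʳ (//-rightDividesˡ y x) ⟨
    x - y + y + v   ≈⟨ +-congʳ (+-congʳ eq) ⟩
    u - v + y + v   ≈⟨ xy∙z≈xz∙y (u - v) y v ⟩
    u - v + v + y   ≈⟨ +-congʳ (//-rightDividesˡ v u) ⟩
    u + y           ∎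

  3+2≈4+1 : 3# + 2# ≈ 4# + 1#
  3+2≈4+1 = sym (+-assoc 3# 1# 1#)

  3+1≈2+2 : 3# + 1# ≈ 2# + 2#
  3+1≈2+2 = +-assoc 2# 1# 1#

  3+3≈4+2 : 3# + 3# ≈ 4# + 2#
  3+3≈4+2 = trans (+-congˡ (+-comm 2# 1#)) (sym (+-assoc 3# 1# 2#))

module PolymatroidProperties {c ℓ : Level} (R : OrderedCommRing c ℓ) where
  open OrderedCommRingProperties R

  submodular-⊆ : ∀ {n} {g : Subset n → Carrier} → IsPolymatroid R g →
                 ∀ {A B C D} → D ⊆ A ∪ B → C ⊆ A ∩ B → g D + g C ≤ g A + g B
  submodular-⊆ pg {A} {B} D⊆A∪B C⊆A∩B =
    ≤-trans (+-mono-≤ (monotone D⊆A∪B) (monotone C⊆A∩B)) (submodular A B)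
    where open IsPolymatroid pg

module PolymatroidExtensionProperties {c ℓ : Level} (R : OrderedCommRing c ℓ) {n : ℕ}
         {f : Subset n → OrderedCommRing.Carrier R}
         {g : Subset (ℕ.suc n) → OrderedCommRing.Carrier R}
         (ext : IsExtension R f g) where
  open OrderedCommRingProperties R
  open PolymatroidProperties R

  cond-zSet≈0⇔ : ∀ X → cond R g zSet (emb X) ≈ 0# ⇔ g (embZ X) ≈ f X
  cond-zSet≈0⇔ X = mk⇔
    (λ cond≈0 → trans (reflexive (≡.cong g (≡.sym (zSet∪emb≡embZ X))))
                      (trans (x-y≈0⇒x≈y _ _ cond≈0) (ext X)))
    (λ g≈f → x≈y⇒x-y≈0
               (trans (reflexive (≡.cong g (zSet∪emb≡embZ X))) (trans g≈f (sym (ext X)))))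

  module _ (pg : IsPolymatroid R g) where
    open IsPolymatroid pg using (monotone)

    f≤g-embZ : ∀ X → f X ≤ g (embZ X)
    f≤g-embZ X = begin
      f X         ≈⟨ ext X ⟨
      g (emb X)   ≤⟨ monotone (out⊆ ⊆-refl) ⟩
      g (embZ X)  ∎

    submodular-embZ : ∀ X Y → g (embZ (Y ∪ X)) + f X ≤ g (embZ X) + f (Y ∪ X)
    submodular-embZ X Y = begin
      g (embZ (Y ∪ X)) + f X        ≈⟨ +-congˡ (ext X) ⟨
      g (embZ (Y ∪ X)) + g (emb X)  ≤⟨ submodular-⊆ pg (in⊆in (q⊆p∪q X (Y ∪ X)))
                                         (out⊆ (λ x∈X → x∈p∩q⁺ (x∈X , q⊆p∪q Y X x∈X))) ⟩
      g (embZ X) + g (emb (Y ∪ X))  ≈⟨ +-congˡ (ext (Y ∪ X)) ⟩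
      g (embZ X) + f (Y ∪ X)        ∎

module AKExtensionProperties {c ℓ : Level} (R : OrderedCommRing c ℓ) {n : ℕ}
         {f : Subset n → OrderedCommRing.Carrier R}
         {g : Subset (ℕ.suc n) → OrderedCommRing.Carrier R}
         {X Y : Subset n} (ak : IsAKExtension R f g X Y) where
  open OrderedCommRingProperties R

  polymatroid : IsPolymatroid R g
  polymatroid = proj₁ ak

  extension : IsExtension R f g
  extension = proj₁ (proj₂ ak)

  open PolymatroidExtensionProperties R {f = f} {g = g} extension public

  g-embZ≈f : g (embZ X) ≈ f X
  g-embZ≈f = Equivalence.to (cond-zSet≈0⇔ X) (proj₁ (proj₂ (proj₂ ak)))

  g-embZ+f≈f+g-zSet : ∀ {X′} → X′ ⊆ X → g (embZ X′) + f Y ≈ f (Y ∪ X′) + g zSet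
  g-embZ+f≈f+g-zSet {X′} X′⊆X = begin-equality
    g (embZ X′) + f Y             ≈⟨ +-cong (reflexive (≡.cong g (emb∪zSet≡embZ X′))) (extension Y) ⟨
    g (emb X′ ∪ zSet) + g (emb Y) ≈⟨ -‿cross (proj₂ (proj₂ (proj₂ ak)) X′ X′⊆X) ⟩
    g (emb (X′ ∪ Y)) + g zSet     ≈⟨ +-congʳ (extension (X′ ∪ Y)) ⟩
    f (X′ ∪ Y) + g zSet           ≈⟨ +-congʳ (reflexive (≡.cong f (∪-comm X′ Y))) ⟩
    f (Y ∪ X′) + g zSet           ∎

module _ {c ℓ : Level} (R : OrderedCommRing c ℓ) where
  open OrderedCommRingProperties R
  open PolymatroidProperties R

  module PairwiseMeetingLines {n : ℕ} {f : Subset n → Carrier} {g : Subset (ℕ.suc n) → Carrier}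
           {L₀ L₁ L₂ : Subset n}
           (f[L₀]≈2 : f L₀ ≈ 2#) (f[L₁]≈2 : f L₁ ≈ 2#) (f[L₂]≈2 : f L₂ ≈ 2#)
           (f[L₀∪L₁]≈3 : f (L₀ ∪ L₁) ≈ 3#) (f[L₀∪L₂]≈3 : f (L₀ ∪ L₂) ≈ 3#)
           (f[L₁∪L₂]≈3 : f (L₁ ∪ L₂) ≈ 3#) (f[L₀∪L₁∪L₂]≈4 : f (L₀ ∪ L₁ ∪ L₂) ≈ 4#)
           (ak : IsAKExtension R f g (L₁ ∪ L₂) L₀) where
    open AKExtensionProperties R ak

    g[z]≈1 : g zSet ≈ 1#
    g[z]≈1 = +-cancelˡ 4# (g zSet) 1# (begin-equality
      4# + g zSet                ≈⟨ +-congʳ f[L₀∪L₁∪L₂]≈4 ⟨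
      f (L₀ ∪ L₁ ∪ L₂) + g zSet  ≈⟨ g-embZ+f≈f+g-zSet ⊆-refl ⟨
      g (embZ (L₁ ∪ L₂)) + f L₀  ≈⟨ +-cong (trans g-embZ≈f f[L₁∪L₂]≈3) f[L₀]≈2 ⟩
      3# + 2#                    ≈⟨ 3+2≈4+1 ⟩
      4# + 1#                    ∎)

    g[z∪Lᵢ]≈2 : ∀ {Lᵢ} → Lᵢ ⊆ L₁ ∪ L₂ → f (L₀ ∪ Lᵢ) ≈ 3# → g (embZ Lᵢ) ≈ 2#
    g[z∪Lᵢ]≈2 {Lᵢ} Lᵢ⊆L₁∪L₂ f[L₀∪Lᵢ]≈3 = +-cancelʳ 2# (g (embZ Lᵢ)) 2# (begin-equality
      g (embZ Lᵢ) + 2#      ≈⟨ +-congˡ f[L₀]≈2 ⟨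
      g (embZ Lᵢ) + f L₀    ≈⟨ g-embZ+f≈f+g-zSet Lᵢ⊆L₁∪L₂ ⟩
      f (L₀ ∪ Lᵢ) + g zSet  ≈⟨ +-cong f[L₀∪Lᵢ]≈3 g[z]≈1 ⟩
      3# + 1#               ≈⟨ 3+1≈2+2 ⟩
      2# + 2#               ∎)

    g[z∪L₁]≈2 : g (embZ L₁) ≈ 2#
    g[z∪L₁]≈2 = g[z∪Lᵢ]≈2 (p⊆p∪q L₂) f[L₀∪L₁]≈3

    g[z∪L₂]≈2 : g (embZ L₂) ≈ 2#
    g[z∪L₂]≈2 = g[z∪Lᵢ]≈2 (q⊆p∪q L₁ L₂) f[L₀∪L₂]≈3

    g[z∪L₀∪Lᵢ]≤3 : ∀ {Lᵢ} → f Lᵢ ≈ 2# → f (L₀ ∪ Lᵢ) ≈ 3# → g (embZ Lᵢ) ≈ 2# →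
                   g (embZ (L₀ ∪ Lᵢ)) ≤ 3#
    g[z∪L₀∪Lᵢ]≤3 {Lᵢ} f[Lᵢ]≈2 f[L₀∪Lᵢ]≈3 g-embZ-Lᵢ≈2 = +-cancelʳ-≤ 2# (begin
      g (embZ (L₀ ∪ Lᵢ)) + 2#    ≈⟨ +-congˡ f[Lᵢ]≈2 ⟨
      g (embZ (L₀ ∪ Lᵢ)) + f Lᵢ  ≤⟨ submodular-embZ polymatroid Lᵢ L₀ ⟩
      g (embZ Lᵢ) + f (L₀ ∪ Lᵢ)  ≈⟨ +-cong g-embZ-Lᵢ≈2 f[L₀∪Lᵢ]≈3 ⟩
      2# + 3#                    ≈⟨ +-comm 2# 3# ⟩
      3# + 2#                    ∎)

    g[z∪L₀]≈2 : g (embZ L₀) ≈ 2#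
    g[z∪L₀]≈2 = antisym g[z∪L₀]≤2 (begin
      2#           ≈⟨ f[L₀]≈2 ⟨
      f L₀         ≤⟨ f≤g-embZ polymatroid L₀ ⟩
      g (embZ L₀)  ∎)
      where
      g[z∪L₀]≤2 : g (embZ L₀) ≤ 2#
      g[z∪L₀]≤2 = +-cancelˡ-≤ 4# (begin
        4# + g (embZ L₀)                         ≈⟨ +-congʳ (trans (extension _) f[L₀∪L₁∪L₂]≈4) ⟨
        g (emb (L₀ ∪ L₁ ∪ L₂)) + g (embZ L₀)     ≤⟨ submodular-⊆ polymatroid
                                                      (out⊆ (p∪[q∪r]⊆[p∪q]∪[p∪r] L₀ L₁ L₂))
                                                      (in⊆in (λ x∈L₀ → x∈p∩q⁺ (p⊆p∪q L₁ x∈L₀ , p⊆p∪q L₂ x∈L₀))) ⟩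
        g (embZ (L₀ ∪ L₁)) + g (embZ (L₀ ∪ L₂))  ≤⟨ +-mono-≤ (g[z∪L₀∪Lᵢ]≤3 f[L₁]≈2 f[L₀∪L₁]≈3 g[z∪L₁]≈2)
                                                            (g[z∪L₀∪Lᵢ]≤3 f[L₂]≈2 f[L₀∪L₂]≈3 g[z∪L₂]≈2) ⟩
        3# + 3#                                  ≈⟨ 3+3≈4+2 ⟩
        4# + 2#                                  ∎)

mainTheorem2 : {c ℓ : Level} (R : OrderedCommRing c ℓ) (n : ℕ)
    (f : Subset n → OrderedCommRing.Carrier R)
    (g : Subset (ℕ.suc n) → OrderedCommRing.Carrier R)
    (L₀ L₁ L₂ : Subset n) →
    IsPolymatroid R f →
    OrderedCommRing._≈_ R (f L₀) (OrderedCommRing.2# R) →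
    OrderedCommRing._≈_ R (f L₁) (OrderedCommRing.2# R) →
    OrderedCommRing._≈_ R (f L₂) (OrderedCommRing.2# R) →
    OrderedCommRing._≈_ R (f (L₀ ∪ L₁)) (OrderedCommRing.3# R) →
    OrderedCommRing._≈_ R (f (L₀ ∪ L₂)) (OrderedCommRing.3# R) →
    OrderedCommRing._≈_ R (f (L₁ ∪ L₂)) (OrderedCommRing.3# R) →
    OrderedCommRing._≈_ R (f (L₀ ∪ L₁ ∪ L₂)) (OrderedCommRing.4# R) →
    IsAKExtension R f g (L₁ ∪ L₂) L₀ →
    OrderedCommRing._≈_ R (cond R g zSet (emb L₀)) (OrderedCommRing.0# R)
    × OrderedCommRing._≈_ R (cond R g zSet (emb L₁)) (OrderedCommRing.0# R)
    × OrderedCommRing._≈_ R (cond R g zSet (emb L₂)) (OrderedCommRing.0# R)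
mainTheorem2 R n f g L₀ L₁ L₂ _ f₀ f₁ f₂ f₀₁ f₀₂ f₁₂ f₀₁₂ ak =
  cond-zSet≈0 L₀ g[z∪L₀]≈2 f₀ , cond-zSet≈0 L₁ g[z∪L₁]≈2 f₁ , cond-zSet≈0 L₂ g[z∪L₂]≈2 f₂
  where
  open OrderedCommRingProperties R
  open AKExtensionProperties R ak using (cond-zSet≈0⇔)
  open PairwiseMeetingLines R f₀ f₁ f₂ f₀₁ f₀₂ f₁₂ f₀₁₂ ak

  cond-zSet≈0 : ∀ L → g (embZ L) ≈ 2# → f L ≈ 2# → cond R g zSet (emb L) ≈ 0#
  cond-zSet≈0 L g[z∪L]≈2 f[L]≈2 = Equivalence.from (cond-zSet≈0⇔ L) (trans g[z∪L]≈2 (sym f[L]≈2))
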